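{- Let $f(x) = x^3+2x^2+2x+1 = (x+1)(x^2+x+1)$. For every integer $k \ge 1$ we have $(1-x^6)^k = f(x)^k \cdot f(-x)^k$, and $$\frac{\min\{\mathrm{ht}(f(x)^k),\ \mathrm{ht}(f(-x)^k)\}}{\mathrm{ht}\bigl((1-x^6)^k\bigr)} \;>\; \frac{3^k}{3k+1}.$$
   Context: The height $\mathrm{ht}(h)$ of $h=\sum c_i x^i\in\mathbb{Z}[x]$ is $\max_i |c_i|$. -}

module Defs where

open import Data.Nat using (ℕ; zero; suc; _⊔_)
open import Data.Integer using (ℤ; +_; -_; ∣_∣) renaming (_+_ to _+ℤ_; _*_ to _*ℤ_)
open import Data.List using (List; []; _∷_; map)

-- Polynomials in ℤ[x] as coefficient lists, lowest degree first:
-- c₀ ∷ c₁ ∷ … represents Σ cᵢ xⁱ.  (Trailing zeros allowed.)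
Poly : Set
Poly = List ℤ

coeff : Poly → ℕ → ℤ
coeff []       _       = + 0
coeff (c ∷ _)  zero    = c
coeff (_ ∷ cs) (suc i) = coeff cs i

_≈ₚ_ : Poly → Poly → Set
p ≈ₚ q = ∀ i → coeff p i ≡ coeff q i
  where open import Relation.Binary.PropositionalEquality using (_≡_)

infix 4 _≈ₚ_

_+ₚ_ : Poly → Poly → Poly
[]       +ₚ q        = q
(a ∷ p)  +ₚ []       = a ∷ p
(a ∷ p)  +ₚ (b ∷ q)  = (a +ℤ b) ∷ (p +ₚ q)

_·ₚ_ : ℤ → Poly → Poly
c ·ₚ p = map (c *ℤ_) p

_*ₚ_ : Poly → Poly → Poly
[]      *ₚ q = []
(a ∷ p) *ₚ q = (a ·ₚ q) +ₚ (+ 0 ∷ (p *ₚ q))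

one : Poly
one = + 1 ∷ []

_^ₚ_ : Poly → ℕ → Poly
p ^ₚ zero  = one
p ^ₚ suc k = p *ₚ (p ^ₚ k)

-- h(x) ↦ h(-x): negate the odd-degree coefficients
negArg : Poly → Poly
negArg = go
  where
  go  : Poly → Poly
  go' : Poly → Poly
  go  []       = []
  go  (c ∷ cs) = c ∷ go' cs
  go' []       = []
  go' (c ∷ cs) = (- c) ∷ go cs

ht : Poly → ℕ
ht []       = 0
ht (c ∷ cs) = ∣ c ∣ ⊔ ht cs

f : Poly
f = + 1 ∷ + 2 ∷ + 2 ∷ + 1 ∷ []

oneMinusX6 : Poly
oneMinusX6 = + 1 ∷ + 0 ∷ + 0 ∷ + 0 ∷ + 0 ∷ + 0 ∷ - (+ 1) ∷ []

module Submission where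

-- A direct coefficient computation gives
--     1 - x⁶ = f(x)·f(-x).  Polynomials under multiplication form a
--     commutative monoid up to coefficientwise equality, and the k-th power
--     in Defs is the monoid's iterated product, so the library fact
--     (p·q)ᵏ = pᵏ·qᵏ for commutative monoids yields (1-x⁶)ᵏ = f(x)ᵏ·f(-x)ᵏ.
--
-- Upper bound: ht(p·q) ≤ ‖p‖₁·ht(q), and ‖1-x⁶‖₁ = 2, so
--      ht((1-x⁶)ᵏ) ≤ 2^(k-1).  Lower bound: for x = ±1 and a polynomial h
--      with at most n coefficients, |h(x)| ≤ n·ht(h).  A power pᵏ of a
--      polynomial of degree ≤ d has at most dk+1 coefficients, and
--      |pᵏ(x)| = |p(x)|ᵏ, hence |p(x)|ᵏ ≤ ht(pᵏ)·(dk+1).  With d = 3 and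
--      f(1) = 6 = f(-x)|_{x=-1} this gives 6ᵏ ≤ ht(·)·(3k+1) for both
--      factors, and 3ᵏ·2^(k-1) < 6ᵏ finishes the inequality.

-- Defs declares no fixities for the polynomial operations; we give them the
-- usual ones so that the algebra below can be written without parentheses.
open import Defs
  renaming (_+ₚ_ to infixl 6 _+ₚ_; _·ₚ_ to infixr 7 _·ₚ_; _*ₚ_ to infixl 7 _*ₚ_; _^ₚ_ to infixr 8 _^ₚ_)
open import Data.Nat using (ℕ; zero; suc; _≤_; _<_; _*_; _+_; _^_; _⊓_; _⊔_; _∸_; z≤n; s≤s)
open import Data.Product using (_×_; _,_)
import Data.Nat.Properties as ℕP
import Data.Nat.Tactic.RingSolver as ℕSolver
import Data.Integer as ℤ
open ℤ using (ℤ; +_; -_; ∣_∣)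
import Data.Integer.Properties as ℤP
open import Data.Integer.Tactic.RingSolver using (solve-∀)
open import Data.List using ([]; _∷_; length)
import Data.List.Properties as ListP
open import Relation.Binary.PropositionalEquality
open import Relation.Binary.Bundles using (Setoid)
open import Relation.Binary.Structures using (IsEquivalence)
open import Algebra.Bundles using (CommutativeMonoid)
open import Algebra.Structures using (IsSemigroup)
open import Algebra.Structures.Biased using (isCommutativeMonoidʳ)
import Algebra.Properties.CommutativeMonoid.Mult as MonoidPower
import Relation.Binary.Reasoning.Setoid as SetoidReasoning
open import Level using (0ℓ)

-- Coefficientwise equality `_≈ₚ_`, packaged as a record so that Agda can
-- infer the two polynomials being compared.
record _≋_ (p q : Poly) : Set where
  constructor coeffwise
  field at : p ≈ₚ q
open _≋_

infix 4 _≋_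

≋-isEquivalence : IsEquivalence _≋_
≋-isEquivalence = record
  { refl  = coeffwise λ _ → refl
  ; sym   = λ e → coeffwise λ i → sym (at e i)
  ; trans = λ e e′ → coeffwise λ i → trans (at e i) (at e′ i)
  }

≋-setoid : Setoid 0ℓ 0ℓ
≋-setoid = record { isEquivalence = ≋-isEquivalence }

module ≋-Reasoning = SetoidReasoning ≋-setoid

open IsEquivalence ≋-isEquivalence using ()
  renaming (refl to ≋-refl; sym to ≋-sym; trans to ≋-trans)

-- Multiplication by x; the product in Defs unfolds as
-- (a ∷ p) *ₚ q = a ·ₚ q +ₚ shift (p *ₚ q).
shift : Poly → Poly
shift p = + 0 ∷ p

coeff-+ₚ : ∀ p q i → coeff (p +ₚ q) i ≡ coeff p i ℤ.+ coeff q i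
coeff-+ₚ []      q       i       = sym (ℤP.+-identityˡ _)
coeff-+ₚ (a ∷ p) []      i       = sym (ℤP.+-identityʳ _)
coeff-+ₚ (a ∷ p) (b ∷ q) zero    = refl
coeff-+ₚ (a ∷ p) (b ∷ q) (suc i) = coeff-+ₚ p q i

coeff-·ₚ : ∀ c p i → coeff (c ·ₚ p) i ≡ c ℤ.* coeff p i
coeff-·ₚ c []      i       = sym (ℤP.*-zeroʳ c)
coeff-·ₚ c (a ∷ p) zero    = refl
coeff-·ₚ c (a ∷ p) (suc i) = coeff-·ₚ c p i

+ₚ-cong : ∀ {p p′ q q′} → p ≋ p′ → q ≋ q′ → p +ₚ q ≋ p′ +ₚ q′
+ₚ-cong {p} {p′} {q} {q′} e e′ = coeffwise λ i → begin
  coeff (p +ₚ q) i            ≡⟨ coeff-+ₚ p q i ⟩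
  coeff p i ℤ.+ coeff q i     ≡⟨ cong₂ ℤ._+_ (at e i) (at e′ i) ⟩
  coeff p′ i ℤ.+ coeff q′ i   ≡⟨ coeff-+ₚ p′ q′ i ⟨
  coeff (p′ +ₚ q′) i          ∎
  where open ≡-Reasoning

·ₚ-cong : ∀ c {p p′} → p ≋ p′ → c ·ₚ p ≋ c ·ₚ p′
·ₚ-cong c {p} {p′} e = coeffwise λ i → begin
  coeff (c ·ₚ p) i    ≡⟨ coeff-·ₚ c p i ⟩
  c ℤ.* coeff p i     ≡⟨ cong (c ℤ.*_) (at e i) ⟩
  c ℤ.* coeff p′ i    ≡⟨ coeff-·ₚ c p′ i ⟨
  coeff (c ·ₚ p′) i   ∎
  where open ≡-Reasoning

shift-cong : ∀ {p p′} → p ≋ p′ → shift p ≋ shift p′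
shift-cong e = coeffwise λ { zero → refl ; (suc i) → at e i }

shift-+ₚ : ∀ p q → shift (p +ₚ q) ≋ shift p +ₚ shift q
shift-+ₚ p q = coeffwise λ { zero → refl ; (suc i) → refl }

shift-·ₚ : ∀ c p → shift (c ·ₚ p) ≋ c ·ₚ shift p
shift-·ₚ c p = coeffwise λ { zero → sym (ℤP.*-zeroʳ c) ; (suc i) → refl }

·ₚ-distrib-+ₚ : ∀ c p q → c ·ₚ (p +ₚ q) ≋ c ·ₚ p +ₚ c ·ₚ q
·ₚ-distrib-+ₚ c p q = coeffwise λ i → begin
  coeff (c ·ₚ (p +ₚ q)) i                  ≡⟨ coeff-·ₚ c (p +ₚ q) i ⟩
  c ℤ.* coeff (p +ₚ q) i                   ≡⟨ cong (c ℤ.*_) (coeff-+ₚ p q i) ⟩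
  c ℤ.* (coeff p i ℤ.+ coeff q i)          ≡⟨ ℤP.*-distribˡ-+ c (coeff p i) (coeff q i) ⟩
  c ℤ.* coeff p i ℤ.+ c ℤ.* coeff q i      ≡⟨ cong₂ ℤ._+_ (coeff-·ₚ c p i) (coeff-·ₚ c q i) ⟨
  coeff (c ·ₚ p) i ℤ.+ coeff (c ·ₚ q) i    ≡⟨ coeff-+ₚ (c ·ₚ p) (c ·ₚ q) i ⟨
  coeff (c ·ₚ p +ₚ c ·ₚ q) i               ∎
  where open ≡-Reasoning

·ₚ-exchange : ∀ a c p → a ·ₚ (c ·ₚ p) ≋ c ·ₚ (a ·ₚ p)
·ₚ-exchange a c p = coeffwise λ i → begin
  coeff (a ·ₚ (c ·ₚ p)) i    ≡⟨ coeff-·ₚ a (c ·ₚ p) i ⟩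
  a ℤ.* coeff (c ·ₚ p) i     ≡⟨ cong (a ℤ.*_) (coeff-·ₚ c p i) ⟩
  a ℤ.* (c ℤ.* coeff p i)    ≡⟨ exchange a c (coeff p i) ⟩
  c ℤ.* (a ℤ.* coeff p i)    ≡⟨ cong (c ℤ.*_) (coeff-·ₚ a p i) ⟨
  c ℤ.* coeff (a ·ₚ p) i     ≡⟨ coeff-·ₚ c (a ·ₚ p) i ⟨
  coeff (c ·ₚ (a ·ₚ p)) i    ∎
  where
  open ≡-Reasoning
  exchange : ∀ a c x → a ℤ.* (c ℤ.* x) ≡ c ℤ.* (a ℤ.* x)
  exchange = solve-∀

+ₚ-interchange : ∀ p q r s → (p +ₚ q) +ₚ (r +ₚ s) ≋ (p +ₚ r) +ₚ (q +ₚ s)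
+ₚ-interchange p q r s = coeffwise λ i → begin
  coeff ((p +ₚ q) +ₚ (r +ₚ s)) i  ≡⟨ expand p q r s i ⟩
  (P i ℤ.+ Q i) ℤ.+ (R i ℤ.+ S i) ≡⟨ interchange (P i) (Q i) (R i) (S i) ⟩
  (P i ℤ.+ R i) ℤ.+ (Q i ℤ.+ S i) ≡⟨ expand p r q s i ⟨
  coeff ((p +ₚ r) +ₚ (q +ₚ s)) i  ∎
  where
  open ≡-Reasoning
  P = coeff p ; Q = coeff q ; R = coeff r ; S = coeff s
  expand : ∀ a b c d i → coeff ((a +ₚ b) +ₚ (c +ₚ d)) i
                       ≡ (coeff a i ℤ.+ coeff b i) ℤ.+ (coeff c i ℤ.+ coeff d i)
  expand a b c d i = trans (coeff-+ₚ (a +ₚ b) (c +ₚ d) i)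
                           (cong₂ ℤ._+_ (coeff-+ₚ a b i) (coeff-+ₚ c d i))
  interchange : ∀ a b c d → (a ℤ.+ b) ℤ.+ (c ℤ.+ d) ≡ (a ℤ.+ c) ℤ.+ (b ℤ.+ d)
  interchange = solve-∀

-- Constant term of a ·ₚ one +ₚ shift p, and of p *ₚ one.
a·1+0≡a : ∀ a → a ℤ.* + 1 ℤ.+ + 0 ≡ a
a·1+0≡a = solve-∀

*ₚ-congˡ : ∀ p {q q′} → q ≋ q′ → p *ₚ q ≋ p *ₚ q′
*ₚ-congˡ []      e = ≋-refl
*ₚ-congˡ (a ∷ p) e = +ₚ-cong (·ₚ-cong a e) (shift-cong (*ₚ-congˡ p e))

*ₚ-identityʳ : ∀ p → p *ₚ one ≋ p
*ₚ-identityʳ []      = ≋-refl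
*ₚ-identityʳ (a ∷ p) = coeffwise λ { zero → a·1+0≡a a ; (suc i) → at (*ₚ-identityʳ p) i }

*ₚ-zeroʳ : ∀ p → p *ₚ [] ≋ []
*ₚ-zeroʳ []      = ≋-refl
*ₚ-zeroʳ (a ∷ p) = coeffwise λ { zero → refl ; (suc i) → at (*ₚ-zeroʳ p) i }

*ₚ-distribˡ-+ₚ : ∀ p q r → p *ₚ (q +ₚ r) ≋ p *ₚ q +ₚ p *ₚ r
*ₚ-distribˡ-+ₚ []      q r = ≋-refl
*ₚ-distribˡ-+ₚ (a ∷ p) q r = begin
  a ·ₚ (q +ₚ r) +ₚ shift (p *ₚ (q +ₚ r))
    ≈⟨ +ₚ-cong (·ₚ-distrib-+ₚ a q r) (shift-cong (*ₚ-distribˡ-+ₚ p q r)) ⟩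
  (a ·ₚ q +ₚ a ·ₚ r) +ₚ shift (p *ₚ q +ₚ p *ₚ r)
    ≈⟨ +ₚ-cong ≋-refl (shift-+ₚ (p *ₚ q) (p *ₚ r)) ⟩
  (a ·ₚ q +ₚ a ·ₚ r) +ₚ (shift (p *ₚ q) +ₚ shift (p *ₚ r))
    ≈⟨ +ₚ-interchange (a ·ₚ q) (a ·ₚ r) (shift (p *ₚ q)) (shift (p *ₚ r)) ⟩
  (a ·ₚ q +ₚ shift (p *ₚ q)) +ₚ (a ·ₚ r +ₚ shift (p *ₚ r))
    ∎
  where open ≋-Reasoning

*ₚ-·ₚ : ∀ p c q → p *ₚ (c ·ₚ q) ≋ c ·ₚ (p *ₚ q)
*ₚ-·ₚ []      c q = ≋-refl
*ₚ-·ₚ (a ∷ p) c q = begin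
  a ·ₚ (c ·ₚ q) +ₚ shift (p *ₚ (c ·ₚ q))
    ≈⟨ +ₚ-cong (·ₚ-exchange a c q) (shift-cong (*ₚ-·ₚ p c q)) ⟩
  c ·ₚ (a ·ₚ q) +ₚ shift (c ·ₚ (p *ₚ q))
    ≈⟨ +ₚ-cong ≋-refl (shift-·ₚ c (p *ₚ q)) ⟩
  c ·ₚ (a ·ₚ q) +ₚ c ·ₚ shift (p *ₚ q)
    ≈⟨ ·ₚ-distrib-+ₚ c (a ·ₚ q) (shift (p *ₚ q)) ⟨
  c ·ₚ (a ·ₚ q +ₚ shift (p *ₚ q))
    ∎
  where open ≋-Reasoning

*ₚ-shift : ∀ p q → p *ₚ shift q ≋ shift (p *ₚ q)
*ₚ-shift []      q = coeffwise λ { zero → refl ; (suc i) → refl }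
*ₚ-shift (a ∷ p) q = coeffwise λ
  { zero    → zero-coeff a
  ; (suc i) → at (+ₚ-cong {a ·ₚ q} ≋-refl (*ₚ-shift p q)) i }
  where
  zero-coeff : ∀ a → a ℤ.* + 0 ℤ.+ + 0 ≡ + 0
  zero-coeff = solve-∀

*ₚ-unfoldʳ : ∀ q a p → q *ₚ (a ∷ p) ≋ a ·ₚ q +ₚ shift (q *ₚ p)
*ₚ-unfoldʳ q a p = begin
  q *ₚ (a ∷ p)                       ≈⟨ *ₚ-congˡ q split ⟩
  q *ₚ (a ·ₚ one +ₚ shift p)         ≈⟨ *ₚ-distribˡ-+ₚ q (a ·ₚ one) (shift p) ⟩
  q *ₚ (a ·ₚ one) +ₚ q *ₚ shift p    ≈⟨ +ₚ-cong (*ₚ-·ₚ q a one) (*ₚ-shift q p) ⟩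
  a ·ₚ (q *ₚ one) +ₚ shift (q *ₚ p)  ≈⟨ +ₚ-cong (·ₚ-cong a (*ₚ-identityʳ q)) ≋-refl ⟩
  a ·ₚ q +ₚ shift (q *ₚ p)           ∎
  where
  open ≋-Reasoning
  split : a ∷ p ≋ a ·ₚ one +ₚ shift p
  split = coeffwise λ { zero → sym (a·1+0≡a a) ; (suc i) → refl }

-- Commutativity: both sides unfold by the same recursion.
*ₚ-comm : ∀ p q → p *ₚ q ≋ q *ₚ p
*ₚ-comm []      q = ≋-sym (*ₚ-zeroʳ q)
*ₚ-comm (a ∷ p) q =
  ≋-trans (+ₚ-cong (≋-refl {a ·ₚ q}) (shift-cong (*ₚ-comm p q))) (≋-sym (*ₚ-unfoldʳ q a p))

-- Associativity, by moving the third factor to the left via commutativity.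
*ₚ-assoc : ∀ p q r → (p *ₚ q) *ₚ r ≋ p *ₚ (q *ₚ r)
*ₚ-assoc []      q r = ≋-refl
*ₚ-assoc (a ∷ p) q r = begin
  (a ·ₚ q +ₚ shift (p *ₚ q)) *ₚ r        ≈⟨ *ₚ-comm (a ·ₚ q +ₚ shift (p *ₚ q)) r ⟩
  r *ₚ (a ·ₚ q +ₚ shift (p *ₚ q))        ≈⟨ *ₚ-distribˡ-+ₚ r (a ·ₚ q) (shift (p *ₚ q)) ⟩
  r *ₚ (a ·ₚ q) +ₚ r *ₚ shift (p *ₚ q)   ≈⟨ +ₚ-cong (*ₚ-·ₚ r a q) (*ₚ-shift r (p *ₚ q)) ⟩
  a ·ₚ (r *ₚ q) +ₚ shift (r *ₚ (p *ₚ q)) ≈⟨ +ₚ-cong (·ₚ-cong a (*ₚ-comm r q)) (shift-cong inner) ⟩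
  a ·ₚ (q *ₚ r) +ₚ shift (p *ₚ (q *ₚ r)) ∎
  where
  open ≋-Reasoning
  inner : r *ₚ (p *ₚ q) ≋ p *ₚ (q *ₚ r)
  inner = ≋-trans (*ₚ-comm r (p *ₚ q)) (*ₚ-assoc p q r)

*ₚ-commutativeMonoid : CommutativeMonoid 0ℓ 0ℓ
*ₚ-commutativeMonoid = record
  { _≈_                 = _≋_
  ; _∙_                 = _*ₚ_
  ; ε                   = one
  ; isCommutativeMonoid = isCommutativeMonoidʳ record
    { isSemigroup = isSemigroup
    ; identityʳ   = *ₚ-identityʳ
    ; comm        = *ₚ-comm
    }
  }
  where
  isSemigroup : IsSemigroup _≋_ _*ₚ_
  isSemigroup = record
    { isMagma = record
      { isEquivalence = ≋-isEquivalence
      ; ∙-cong        = λ {p} {p′} {q} {q′} e e′ →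
          ≋-trans (*ₚ-congˡ p e′) (≋-trans (*ₚ-comm p q′)
            (≋-trans (*ₚ-congˡ q′ e) (*ₚ-comm q′ p′)))
      }
    ; assoc = *ₚ-assoc
    }

open MonoidPower *ₚ-commutativeMonoid using (×-congʳ; ×-distrib-+)
  renaming (_×_ to _×ₘ_)

^ₚ-is-monoid-power : ∀ p k → p ^ₚ k ≡ k ×ₘ p
^ₚ-is-monoid-power p zero    = refl
^ₚ-is-monoid-power p (suc k) = cong (p *ₚ_) (^ₚ-is-monoid-power p k)

^ₚ-cong : ∀ k {p p′} → p ≋ p′ → p ^ₚ k ≋ p′ ^ₚ k
^ₚ-cong k {p} {p′} e
  rewrite ^ₚ-is-monoid-power p k | ^ₚ-is-monoid-power p′ k = ×-congʳ k e

^ₚ-distrib-*ₚ : ∀ p q k → (p *ₚ q) ^ₚ k ≋ p ^ₚ k *ₚ q ^ₚ k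
^ₚ-distrib-*ₚ p q k
  rewrite ^ₚ-is-monoid-power (p *ₚ q) k | ^ₚ-is-monoid-power p k
        | ^ₚ-is-monoid-power q k = ×-distrib-+ p q k

oneMinusX6-factorisation : oneMinusX6 ≋ f *ₚ negArg f
oneMinusX6-factorisation = coeffwise λ
  { 0 → refl ; 1 → refl ; 2 → refl ; 3 → refl ; 4 → refl ; 5 → refl ; 6 → refl
  ; (suc (suc (suc (suc (suc (suc (suc i))))))) → refl }

factorisation-^ : ∀ k → oneMinusX6 ^ₚ k ≋ f ^ₚ k *ₚ negArg f ^ₚ k
factorisation-^ k =
  ≋-trans (^ₚ-cong k oneMinusX6-factorisation) (^ₚ-distrib-*ₚ f (negArg f) k)

CoeffBound : Poly → ℕ → Set
CoeffBound p B = ∀ i → ∣ coeff p i ∣ ≤ B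

ht-bounds : ∀ p → CoeffBound p (ht p)
ht-bounds []       i       = z≤n
ht-bounds (c ∷ cs) zero    = ℕP.m≤m⊔n ∣ c ∣ (ht cs)
ht-bounds (c ∷ cs) (suc i) = ℕP.≤-trans (ht-bounds cs i) (ℕP.m≤n⊔m ∣ c ∣ (ht cs))

ht-least : ∀ p {B} → CoeffBound p B → ht p ≤ B
ht-least []       b = z≤n
ht-least (c ∷ cs) b = ℕP.⊔-lub (b zero) (ht-least cs (λ i → b (suc i)))

bound-+ₚ : ∀ p q {B C} → CoeffBound p B → CoeffBound q C → CoeffBound (p +ₚ q) (B + C)
bound-+ₚ p q b b′ i rewrite coeff-+ₚ p q i =
  ℕP.≤-trans (ℤP.∣i+j∣≤∣i∣+∣j∣ (coeff p i) (coeff q i)) (ℕP.+-mono-≤ (b i) (b′ i))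

bound-·ₚ : ∀ c p {B} → CoeffBound p B → CoeffBound (c ·ₚ p) (∣ c ∣ * B)
bound-·ₚ c p b i rewrite coeff-·ₚ c p i | ℤP.abs-* c (coeff p i) = ℕP.*-monoʳ-≤ ∣ c ∣ (b i)

bound-shift : ∀ p {B} → CoeffBound p B → CoeffBound (shift p) B
bound-shift p b zero    = z≤n
bound-shift p b (suc i) = b i

norm₁ : Poly → ℕ
norm₁ []       = 0
norm₁ (c ∷ cs) = ∣ c ∣ + norm₁ cs

-- Each coefficient of p·q is a sum of terms aᵢ·q_{j-i}.
bound-*ₚ : ∀ p q {B} → CoeffBound q B → CoeffBound (p *ₚ q) (norm₁ p * B)
bound-*ₚ []      q b i = z≤n
bound-*ₚ (a ∷ p) q {B} b i rewrite ℕP.*-distribʳ-+ B ∣ a ∣ (norm₁ p) =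
  bound-+ₚ (a ·ₚ q) (shift (p *ₚ q)) (bound-·ₚ a q b) (bound-shift (p *ₚ q) (bound-*ₚ p q b)) i

ht-*ₚ : ∀ p q → ht (p *ₚ q) ≤ norm₁ p * ht q
ht-*ₚ p q = ht-least (p *ₚ q) (bound-*ₚ p q (ht-bounds q))

-- Since ‖1 - x⁶‖₁ = 2, the height of (1-x⁶)^(m+1) is at most 2ᵐ.
ht-oneMinusX6-^ : ∀ m → ht (oneMinusX6 ^ₚ suc m) ≤ 2 ^ m
ht-oneMinusX6-^ zero    = ℕP.≤-refl
ht-oneMinusX6-^ (suc m) =
  ℕP.≤-trans (ht-*ₚ oneMinusX6 (oneMinusX6 ^ₚ suc m)) (ℕP.*-monoʳ-≤ 2 (ht-oneMinusX6-^ m))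

eval : Poly → ℤ → ℤ
eval []       x = + 0
eval (c ∷ cs) x = c ℤ.+ x ℤ.* eval cs x

eval-+ₚ : ∀ p q x → eval (p +ₚ q) x ≡ eval p x ℤ.+ eval q x
eval-+ₚ []      q       x = sym (ℤP.+-identityˡ _)
eval-+ₚ (a ∷ p) []      x = sym (ℤP.+-identityʳ _)
eval-+ₚ (a ∷ p) (b ∷ q) x rewrite eval-+ₚ p q x = regroup a b x (eval p x) (eval q x)
  where
  regroup : ∀ a b x u v → (a ℤ.+ b) ℤ.+ x ℤ.* (u ℤ.+ v) ≡ (a ℤ.+ x ℤ.* u) ℤ.+ (b ℤ.+ x ℤ.* v)
  regroup = solve-∀

eval-·ₚ : ∀ c p x → eval (c ·ₚ p) x ≡ c ℤ.* eval p x
eval-·ₚ c []      x = sym (ℤP.*-zeroʳ c)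
eval-·ₚ c (a ∷ p) x rewrite eval-·ₚ c p x = regroup c a x (eval p x)
  where
  regroup : ∀ c a x u → c ℤ.* a ℤ.+ x ℤ.* (c ℤ.* u) ≡ c ℤ.* (a ℤ.+ x ℤ.* u)
  regroup = solve-∀

eval-*ₚ : ∀ p q x → eval (p *ₚ q) x ≡ eval p x ℤ.* eval q x
eval-*ₚ []      q x = sym (ℤP.*-zeroˡ (eval q x))
eval-*ₚ (a ∷ p) q x
  rewrite eval-+ₚ (a ·ₚ q) (shift (p *ₚ q)) x | eval-·ₚ a q x | eval-*ₚ p q x =
  regroup a x (eval p x) (eval q x)
  where
  regroup : ∀ a x u v → a ℤ.* v ℤ.+ (+ 0 ℤ.+ x ℤ.* (u ℤ.* v)) ≡ (a ℤ.+ x ℤ.* u) ℤ.* v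
  regroup = solve-∀

∣eval-^ₚ∣ : ∀ p k x → ∣ eval (p ^ₚ k) x ∣ ≡ ∣ eval p x ∣ ^ k
∣eval-^ₚ∣ p zero    x rewrite ℤP.*-zeroʳ x = refl
∣eval-^ₚ∣ p (suc k) x = begin
  ∣ eval (p *ₚ p ^ₚ k) x ∣               ≡⟨ cong ∣_∣ (eval-*ₚ p (p ^ₚ k) x) ⟩
  ∣ eval p x ℤ.* eval (p ^ₚ k) x ∣       ≡⟨ ℤP.abs-* (eval p x) (eval (p ^ₚ k) x) ⟩
  ∣ eval p x ∣ * ∣ eval (p ^ₚ k) x ∣     ≡⟨ cong (∣ eval p x ∣ *_) (∣eval-^ₚ∣ p k x) ⟩
  ∣ eval p x ∣ * ∣ eval p x ∣ ^ k        ∎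
  where open ≡-Reasoning

-- At a unit x = ±1 every term of h(x) has absolute value at most ht(h),
-- so |h(x)| ≤ (number of coefficients)·ht(h).
∣eval-unit∣ : ∀ p x → ∣ x ∣ ≡ 1 → ∣ eval p x ∣ ≤ length p * ht p
∣eval-unit∣ []       x x-unit = z≤n
∣eval-unit∣ (c ∷ cs) x x-unit = begin
  ∣ c ℤ.+ x ℤ.* eval cs x ∣          ≤⟨ ℤP.∣i+j∣≤∣i∣+∣j∣ c (x ℤ.* eval cs x) ⟩
  ∣ c ∣ + ∣ x ℤ.* eval cs x ∣        ≡⟨ cong (_+_ ∣ c ∣) unit-factor ⟩
  ∣ c ∣ + ∣ eval cs x ∣              ≤⟨ ℕP.+-monoʳ-≤ ∣ c ∣ (∣eval-unit∣ cs x x-unit) ⟩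
  ∣ c ∣ + length cs * ht cs          ≤⟨ ℕP.+-mono-≤ (ℕP.m≤m⊔n ∣ c ∣ (ht cs))
                                          (ℕP.*-monoʳ-≤ (length cs) (ℕP.m≤n⊔m ∣ c ∣ (ht cs))) ⟩
  ht (c ∷ cs) + length cs * ht (c ∷ cs) ∎
  where
  open ℕP.≤-Reasoning
  unit-factor : ∣ x ℤ.* eval cs x ∣ ≡ ∣ eval cs x ∣
  unit-factor = trans (ℤP.abs-* x (eval cs x))
                      (trans (cong (_* ∣ eval cs x ∣) x-unit) (ℕP.*-identityˡ _))

length-+ₚ : ∀ p q → length (p +ₚ q) ≡ length p ⊔ length q
length-+ₚ []      q       = refl
length-+ₚ (a ∷ p) []      = refl
length-+ₚ (a ∷ p) (b ∷ q) = cong suc (length-+ₚ p q)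

length-*ₚ : ∀ p q → length (p *ₚ q) ≤ length p + (length q ∸ 1)
length-*ₚ []      q = z≤n
length-*ₚ (a ∷ p) q rewrite length-+ₚ (a ·ₚ q) (shift (p *ₚ q)) | ListP.length-map (a ℤ.*_) q =
  ℕP.⊔-lub (ℕP.≤-trans (n≤1+[n∸1] (length q)) (s≤s (ℕP.m≤n+m (length q ∸ 1) (length p))))
           (s≤s (length-*ₚ p q))
  where
  n≤1+[n∸1] : ∀ n → n ≤ suc (n ∸ 1)
  n≤1+[n∸1] zero    = z≤n
  n≤1+[n∸1] (suc n) = ℕP.≤-refl

length-^ₚ : ∀ d p → length p ≤ suc d → ∀ k → length (p ^ₚ k) ≤ d * k + 1
length-^ₚ d p deg zero    = ℕP.≤-reflexive (sym (cong (_+ 1) (ℕP.*-zeroʳ d)))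
length-^ₚ d p deg (suc k) = begin
  length (p *ₚ p ^ₚ k)              ≤⟨ length-*ₚ p (p ^ₚ k) ⟩
  length p + (length (p ^ₚ k) ∸ 1)  ≤⟨ ℕP.+-mono-≤ deg (ℕP.∸-monoˡ-≤ 1 (length-^ₚ d p deg k)) ⟩
  suc d + (d * k + 1 ∸ 1)           ≡⟨ cong (_+_ (suc d)) (ℕP.m+n∸n≡m (d * k) 1) ⟩
  suc d + d * k                     ≡⟨ regroup d k ⟩
  d * suc k + 1                     ∎
  where
  open ℕP.≤-Reasoning
  regroup : ∀ d k → suc d + d * k ≡ d * suc k + 1
  regroup = ℕSolver.solve-∀

ht-^ₚ-lower : ∀ d p x → ∣ x ∣ ≡ 1 → length p ≤ suc d → ∀ k →
              ∣ eval p x ∣ ^ k ≤ ht (p ^ₚ k) * (d * k + 1)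
ht-^ₚ-lower d p x x-unit deg k = begin
  ∣ eval p x ∣ ^ k              ≡⟨ ∣eval-^ₚ∣ p k x ⟨
  ∣ eval (p ^ₚ k) x ∣           ≤⟨ ∣eval-unit∣ (p ^ₚ k) x x-unit ⟩
  length (p ^ₚ k) * ht (p ^ₚ k) ≤⟨ ℕP.*-monoˡ-≤ (ht (p ^ₚ k)) (length-^ₚ d p deg k) ⟩
  (d * k + 1) * ht (p ^ₚ k)     ≡⟨ ℕP.*-comm (d * k + 1) (ht (p ^ₚ k)) ⟩
  ht (p ^ₚ k) * (d * k + 1)     ∎
  where open ℕP.≤-Reasoning

three-two-six : ∀ m → 3 ^ suc m * 2 ^ m < 6 ^ suc m
three-two-six m = begin-strict
  3 ^ suc m * 2 ^ m      <⟨ ℕP.*-monoʳ-< (3 ^ suc m) {{ℕP.m^n≢0 3 (suc m)}}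
                              (ℕP.^-monoʳ-< 2 ℕP.≤-refl (ℕP.n<1+n m)) ⟩
  3 ^ suc m * 2 ^ suc m  ≡⟨ ^-distribʳ-* 3 2 (suc m) ⟨
  6 ^ suc m              ∎
  where
  open ℕP.≤-Reasoning
  ^-distribʳ-* : ∀ a b n → (a * b) ^ n ≡ a ^ n * b ^ n
  ^-distribʳ-* a b zero    = refl
  ^-distribʳ-* a b (suc n) = trans (cong (a * b *_) (^-distribʳ-* a b n)) (interchange a b _ _)
    where
    interchange : ∀ a b u v → a * b * (u * v) ≡ a * u * (b * v)
    interchange = ℕSolver.solve-∀

mainTheorem5 : (k : ℕ) → 1 ≤ k →
    ((oneMinusX6 ^ₚ k) ≈ₚ ((f ^ₚ k) *ₚ (negArg f ^ₚ k)))
    × (3 ^ k * ht (oneMinusX6 ^ₚ k) < (ht (f ^ₚ k) ⊓ ht (negArg f ^ₚ k)) * (3 * k + 1))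
mainTheorem5 k@(suc m) _ = at (factorisation-^ k) , (begin-strict
  3 ^ k * ht (oneMinusX6 ^ₚ k)       ≤⟨ ℕP.*-monoʳ-≤ (3 ^ k) (ht-oneMinusX6-^ m) ⟩
  3 ^ k * 2 ^ m                      <⟨ three-two-six m ⟩
  6 ^ k                              ≤⟨ ℕP.⊓-glb f-lower negArg-f-lower ⟩
  (ht (f ^ₚ k) * (3 * k + 1)) ⊓ (ht (negArg f ^ₚ k) * (3 * k + 1))
                                     ≡⟨ ℕP.*-distribʳ-⊓ (3 * k + 1) (ht (f ^ₚ k)) (ht (negArg f ^ₚ k)) ⟨
  (ht (f ^ₚ k) ⊓ ht (negArg f ^ₚ k)) * (3 * k + 1) ∎)
  where
  open ℕP.≤-Reasoning
  -- f(1) = 6 and f(-x) at x = -1 is again 6; both have degree 3.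
  f-lower : 6 ^ k ≤ ht (f ^ₚ k) * (3 * k + 1)
  f-lower = ht-^ₚ-lower 3 f (+ 1) refl ℕP.≤-refl k
  negArg-f-lower : 6 ^ k ≤ ht (negArg f ^ₚ k) * (3 * k + 1)
  negArg-f-lower = ht-^ₚ-lower 3 (negArg f) (- (+ 1)) refl ℕP.≤-refl k
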